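{- For every (possibly open) pure context $E$, term $t$, and variable $x\notin\mathrm{fv}(E)$: $(\lambda x.E[x])\,t\approx_{nf}E[t]$.
   Context: Calculus $\lambda_S$: terms $t ::= v \mid t\,t \mid \mathcal{S}k.t \mid \langle t\rangle$, values $v ::= x \mid \lambda x.t$; pure contexts $E ::= \square \mid v\,E \mid E\,t$; evaluation contexts $F ::= \square \mid v\,F \mid F\,t \mid \langle F\rangle$ (each either pure or uniquely $F[\langle E\rangle]$ with $E$ pure). Reduction on open terms: $F[(\lambda x.t)\,v] \to F[t\{v/x\}]$; $F[\langle E[\mathcal{S}k.t]\rangle] \to F[\langle t\{\lambda x.\langle E[x]\rangle/k\}\rangle]$ ($x\notin\mathrm{fv}(E)$); $F[\langle v\rangle]\to F[v]$. Stuck terms: control-stuck $E[\mathcal{S}k.t]$ and open-stuck $F[x\,v]$; normal form: value or stuck; $t\Downarrow t'$: $t\to^*t'$, $t'$ normal form. Extensions of a relation $R$ ($x$ fresh): $E_0\,R^c\,E_1$ iff $E_0[x]\,R\,E_1[x]$; $F_0[\langle E_0\rangle]\,R^c\,F_1[\langle E_1\rangle]$ iff $\langle E_0[x]\rangle\,R\,\langle E_1[x]\rangle$ and $F_0[x]\,R\,F_1[x]$ (no other pairs); $v_0\,R^v\,v_1$ iff $v_0\,x\,R\,v_1\,x$; $E_0[\mathcal{S}k.t_0]\,R^{nf}\,E_1[\mathcal{S}k.t_1]$ iff $E_0\,R^c\,E_1$ and $\langle t_0\rangle\,R\,\langle t_1\rangle$; $F_0[y\,v_0]\,R^{nf}\,F_1[y\,v_1]$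 iff $F_0\,R^c\,F_1$ and $v_0\,R^v\,v_1$. A normal-form bisimulation is a relation $R$ on open terms such that $t_0\,R\,t_1$ implies: if $t_0\to t_0'$ then $t_1\to^*t_1'$ with $t_0'\,R\,t_1'$; if $t_0$ is a value then $t_1\Downarrow v_1$ with $t_0\,R^v\,v_1$; if $t_0$ is stuck then $t_1\Downarrow t_1'$ with $t_0\,R^{nf}\,t_1'$; and symmetrically. $\approx_{nf}$ is the largest normal-form bisimulation. -}

module Defs where

open import Data.Nat using (ℕ; zero; suc)
open import Data.Product using (Σ; ∃; _×_; _,_)
open import Data.Sum using (_⊎_)
open import Relation.Binary.PropositionalEquality using (_≡_)

-- Syntax of λ_S, locally nameless-free: de Bruijn indices, all free
-- indices are the free variables of an open term.
--   lam t    : λx.t        (index 0 in t is x)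
--   shift t  : S k.t       (index 0 in t is k)
--   reset t  : ⟨ t ⟩

data Tm : Set where
  var   : ℕ → Tm
  lam   : Tm → Tm
  app   : Tm → Tm → Tm
  shift : Tm → Tm
  reset : Tm → Tm

data Val : Tm → Set where
  var : ∀ n → Val (var n)
  lam : ∀ t → Val (lam t)

ext : (ℕ → ℕ) → ℕ → ℕ
ext ρ zero    = zero
ext ρ (suc n) = suc (ρ n)

ren : (ℕ → ℕ) → Tm → Tm
ren ρ (var n)   = var (ρ n)
ren ρ (lam t)   = lam (ren (ext ρ) t)
ren ρ (app t u) = app (ren ρ t) (ren ρ u)
ren ρ (shift t) = shift (ren (ext ρ) t)
ren ρ (reset t) = reset (ren ρ t)

exts : (ℕ → Tm) → ℕ → Tm
exts σ zero    = var zero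
exts σ (suc n) = ren suc (σ n)

sub : (ℕ → Tm) → Tm → Tm
sub σ (var n)   = σ n
sub σ (lam t)   = lam (sub (exts σ) t)
sub σ (app t u) = app (sub σ t) (sub σ u)
sub σ (shift t) = shift (sub (exts σ) t)
sub σ (reset t) = reset (sub σ t)

σ₀ : Tm → ℕ → Tm
σ₀ v zero    = v
σ₀ v (suc n) = var n

_[_] : Tm → Tm → Tm
t [ v ] = sub (σ₀ v) t

wk : Tm → Tm
wk = ren suc

renVal : ∀ ρ {v} → Val v → Val (ren ρ v)
renVal ρ (var n) = var (ρ n)
renVal ρ (lam t) = lam (ren (ext ρ) t)

data PCtx : Set where
  hole : PCtx
  valE : (v : Tm) → Val v → PCtx → PCtx
  funE : PCtx → Tm → PCtx

plugE : PCtx → Tm → Tm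
plugE hole         s = s
plugE (valE v _ E) s = app v (plugE E s)
plugE (funE E t)   s = app (plugE E s) t

renE : (ℕ → ℕ) → PCtx → PCtx
renE ρ hole         = hole
renE ρ (valE v p E) = valE (ren ρ v) (renVal ρ p) (renE ρ E)
renE ρ (funE E t)   = funE (renE ρ E) (ren ρ t)

wkE : PCtx → PCtx
wkE = renE suc

-- Evaluation contexts F ::= □ | v F | F t | ⟨F⟩, represented through
-- their unique decomposition: either pure, or F[⟨E⟩] with E pure.
data ECtx : Set where
  pure  : PCtx → ECtx
  delim : ECtx → PCtx → ECtx

plugF : ECtx → Tm → Tm
plugF (pure E)    s = plugE E s
plugF (delim F E) s = plugF F (reset (plugE E s))

renF : (ℕ → ℕ) → ECtx → ECtx
renF ρ (pure E)    = pure (renE ρ E)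
renF ρ (delim F E) = delim (renF ρ F) (renE ρ E)

wkF : ECtx → ECtx
wkF = renF suc

data _⟶_ : Tm → Tm → Set where
  βv    : ∀ F t v → Val v →
          plugF F (app (lam t) v) ⟶ plugF F (t [ v ])
  shft  : ∀ F E t →
          plugF F (reset (plugE E (shift t)))
            ⟶ plugF F (reset (t [ lam (reset (plugE (wkE E) (var zero))) ]))
  rst   : ∀ F v → Val v →
          plugF F (reset v) ⟶ plugF F v

data _⟶*_ : Tm → Tm → Set where
  done : ∀ {t} → t ⟶* t
  step : ∀ {t t' t''} → t ⟶ t' → t' ⟶* t'' → t ⟶* t''

ControlStuck : Tm → Set
ControlStuck s = Σ PCtx λ E → Σ Tm λ t → s ≡ plugE E (shift t)

OpenStuck : Tm → Set
OpenStuck s = Σ ECtx λ F → Σ ℕ λ x → Σ Tm λ v → Val v × (s ≡ plugF F (app (var x) v))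

Stuck : Tm → Set
Stuck s = ControlStuck s ⊎ OpenStuck s

NormalForm : Tm → Set
NormalForm s = Val s ⊎ Stuck s

_⇓_ : Tm → Tm → Set
t ⇓ t' = (t ⟶* t') × NormalForm t'

-- Extensions of a relation R (the fresh variable is index 0, after
-- weakening the compared objects)

Rel : Set₁
Rel = Tm → Tm → Set

ExtC : Rel → PCtx → PCtx → Set
ExtC R E₀ E₁ = R (plugE (wkE E₀) (var zero)) (plugE (wkE E₁) (var zero))

data ExtCF (R : Rel) : ECtx → ECtx → Set where
  pure  : ∀ {E₀ E₁} → ExtC R E₀ E₁ → ExtCF R (pure E₀) (pure E₁)
  delim : ∀ {F₀ F₁ E₀ E₁} →
          R (reset (plugE (wkE E₀) (var zero))) (reset (plugE (wkE E₁) (var zero))) →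
          R (plugF (wkF F₀) (var zero)) (plugF (wkF F₁) (var zero)) →
          ExtCF R (delim F₀ E₀) (delim F₁ E₁)

ExtV : Rel → Tm → Tm → Set
ExtV R v₀ v₁ = R (app (wk v₀) (var zero)) (app (wk v₁) (var zero))

data ExtNF (R : Rel) : Tm → Tm → Set where
  ctrl : ∀ {E₀ E₁ t₀ t₁} → ExtC R E₀ E₁ → R (reset t₀) (reset t₁) →
         ExtNF R (plugE E₀ (shift t₀)) (plugE E₁ (shift t₁))
  open' : ∀ {F₀ F₁ y v₀ v₁} → Val v₀ → Val v₁ → ExtCF R F₀ F₁ → ExtV R v₀ v₁ →
          ExtNF R (plugF F₀ (app (var y) v₀)) (plugF F₁ (app (var y) v₁))

flipR : Rel → Rel
flipR R a b = R b a

Progress : Rel → Set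
Progress R = ∀ {t₀ t₁} → R t₀ t₁ →
    (∀ {t₀'} → t₀ ⟶ t₀' → Σ Tm λ t₁' → (t₁ ⟶* t₁') × R t₀' t₁')
  × (Val t₀ → Σ Tm λ v₁ → (t₁ ⇓ v₁) × Val v₁ × ExtV R t₀ v₁)
  × (Stuck t₀ → Σ Tm λ t₁' → (t₁ ⇓ t₁') × ExtNF R t₀ t₁')

IsNFBisim : Rel → Set
IsNFBisim R = Progress R × Progress (flipR R)

_≈nf_ : Tm → Tm → Set₁
t₀ ≈nf t₁ = Σ Rel λ R → IsNFBisim R × R t₀ t₁

-- The relation pairing every t with itself and (λx.E[x]) t with E[t] is a
-- normal-form bisimulation. If t is a value, the left side β-reduces to E[t] in
-- one step and the two sides behave identically afterwards. Otherwise both sides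
-- are E'[t] for the pure contexts E' = (λx.E[x]) □ and E' = E, and by unique
-- decomposition a pure context around a non-value is inert: E'[t] steps exactly
-- when t does and is stuck exactly when t is. Steps of t keep the pair in the
-- relation, and when t is stuck the two sides differ only in their outer pure
-- contexts, whose plugged versions are again such a pair.
module Submission where

open import Defs
open import Data.Nat using (ℕ; zero; suc)
open import Data.Product using (Σ; _×_; _,_; proj₁; proj₂)
open import Data.Sum using (inj₁; inj₂)
open import Data.Empty using (⊥-elim)
open import Function using (_∘_)
open import Relation.Nullary using (¬_; Dec; yes; no)
open import Relation.Binary.PropositionalEquality
  using (_≡_; refl; sym; trans; cong; cong₂; subst; subst₂)

private variable
  a b c d r r' s t t' u v w : Tm
  ρ ρ' ρ'' : ℕ → ℕ
  σ : ℕ → Tm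
  Q : Rel

Val? : ∀ t → Dec (Val t)
Val? (var n)   = yes (var n)
Val? (lam t)   = yes (lam t)
Val? (app t u) = no λ ()
Val? (shift t) = no λ ()
Val? (reset t) = no λ ()

Val-irrelevant : (p q : Val v) → p ≡ q
Val-irrelevant (var n) (var n) = refl
Val-irrelevant (lam t) (lam t) = refl

plugE-Val : ∀ E → Val (plugE E t) → Val t
plugE-Val hole p = p

app-injective : app a b ≡ app c d → a ≡ c × b ≡ d
app-injective refl = refl , refl

ext-fusion : (∀ n → ρ (ρ' n) ≡ ρ'' n) → ∀ n → ext ρ (ext ρ' n) ≡ ext ρ'' n
ext-fusion h zero    = refl
ext-fusion h (suc n) = cong suc (h n)

ren-fusion : (∀ n → ρ (ρ' n) ≡ ρ'' n) → ∀ t → ren ρ (ren ρ' t) ≡ ren ρ'' t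
ren-fusion h (var n)   = cong var (h n)
ren-fusion h (lam t)   = cong lam (ren-fusion (ext-fusion h) t)
ren-fusion h (app t u) = cong₂ app (ren-fusion h t) (ren-fusion h u)
ren-fusion h (shift t) = cong shift (ren-fusion (ext-fusion h) t)
ren-fusion h (reset t) = cong reset (ren-fusion h t)

ren-ext-wk : ∀ ρ v → ren (ext ρ) (wk v) ≡ wk (ren ρ v)
ren-ext-wk ρ v = trans (ren-fusion {ρ'' = suc ∘ ρ} (λ _ → refl) v) (sym (ren-fusion (λ _ → refl) v))

exts-inverse : (∀ n → σ (ρ n) ≡ var n) → ∀ n → exts σ (ext ρ n) ≡ var n
exts-inverse h zero    = refl
exts-inverse h (suc n) = cong wk (h n)

sub-ren-inverse : (∀ n → σ (ρ n) ≡ var n) → ∀ t → sub σ (ren ρ t) ≡ t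
sub-ren-inverse h (var n)   = h n
sub-ren-inverse h (lam t)   = cong lam (sub-ren-inverse (exts-inverse h) t)
sub-ren-inverse h (app t u) = cong₂ app (sub-ren-inverse h t) (sub-ren-inverse h u)
sub-ren-inverse h (shift t) = cong shift (sub-ren-inverse (exts-inverse h) t)
sub-ren-inverse h (reset t) = cong reset (sub-ren-inverse h t)

wk-[] : ∀ v t → wk v [ t ] ≡ v
wk-[] v t = sub-ren-inverse (λ _ → refl) v

bodyE : PCtx → Tm
bodyE E = plugE (wkE E) (var zero)

lamE : PCtx → Tm
lamE E = lam (bodyE E)

bodyE-[] : ∀ E t → bodyE E [ t ] ≡ plugE E t
bodyE-[] hole         t = refl
bodyE-[] (valE v p E) t = cong₂ app (wk-[] v t) (bodyE-[] E t)
bodyE-[] (funE E u)   t = cong₂ app (bodyE-[] E t) (wk-[] u t)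

ren-bodyE : ∀ ρ E → ren (ext ρ) (bodyE E) ≡ bodyE (renE ρ E)
ren-bodyE ρ hole         = refl
ren-bodyE ρ (valE v p E) = cong₂ app (ren-ext-wk ρ v) (ren-bodyE ρ E)
ren-bodyE ρ (funE E u)   = cong₂ app (ren-bodyE ρ E) (ren-ext-wk ρ u)

appLamE : PCtx → PCtx
appLamE E = valE (lamE E) (lam (bodyE E)) hole

infixr 20 _∘ᴱ_ _∘ᶠ_

_∘ᴱ_ : PCtx → PCtx → PCtx
hole       ∘ᴱ E' = E'
valE v p E ∘ᴱ E' = valE v p (E ∘ᴱ E')
funE E u   ∘ᴱ E' = funE (E ∘ᴱ E') u

_∘ᶠ_ : PCtx → ECtx → ECtx
E ∘ᶠ pure E'    = pure (E ∘ᴱ E')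
E ∘ᶠ delim F E' = delim (E ∘ᶠ F) E'

plugE-∘ : ∀ E E' t → plugE (E ∘ᴱ E') t ≡ plugE E (plugE E' t)
plugE-∘ hole         E' t = refl
plugE-∘ (valE v p E) E' t = cong (app v) (plugE-∘ E E' t)
plugE-∘ (funE E u)   E' t = cong (λ s → app s u) (plugE-∘ E E' t)

plugF-∘ : ∀ E F t → plugF (E ∘ᶠ F) t ≡ plugE E (plugF F t)
plugF-∘ E (pure E')    t = plugE-∘ E E' t
plugF-∘ E (delim F E') t = plugF-∘ E F (reset (plugE E' t))

renE-∘ : ∀ ρ E E' → renE ρ (E ∘ᴱ E') ≡ renE ρ E ∘ᴱ renE ρ E'
renE-∘ ρ hole         E' = refl
renE-∘ ρ (valE v p E) E' = cong (valE (ren ρ v) (renVal ρ p)) (renE-∘ ρ E E')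
renE-∘ ρ (funE E u)   E' = cong (λ E'' → funE E'' (ren ρ u)) (renE-∘ ρ E E')

renF-∘ : ∀ ρ E F → renF ρ (E ∘ᶠ F) ≡ renE ρ E ∘ᶠ renF ρ F
renF-∘ ρ E (pure E')    = cong pure (renE-∘ ρ E E')
renF-∘ ρ E (delim F E') = cong (λ F' → delim F' (renE ρ E')) (renF-∘ ρ E F)

plugF-wk-∘ : ∀ E F t → plugF (wkF (E ∘ᶠ F)) t ≡ plugE (wkE E) (plugF (wkF F) t)
plugF-wk-∘ E F t = trans (cong (λ F' → plugF F' t) (renF-∘ suc E F)) (plugF-∘ (wkE E) (wkF F) t)

-- The possible holes of a redex or stuck term: a pure context around a
-- non-value can never swallow one of them, whence unique decomposition.
data Atomic : Tm → Set where
  app   : Val a → Val b → Atomic (app a b)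
  shift : Atomic (shift t)
  reset : Atomic (reset t)

Atomic-¬Val : Atomic r → ¬ Val r
Atomic-¬Val (app _ _) ()
Atomic-¬Val shift ()
Atomic-¬Val reset ()

decomposeE : ∀ E E₂ → ¬ Val t → Atomic r → plugE E t ≡ plugE E₂ r →
             Σ PCtx λ E₃ → (E₂ ≡ E ∘ᴱ E₃) × (t ≡ plugE E₃ r)
decomposeE hole E₂ _ _ eq = E₂ , refl , eq
decomposeE (valE w p E) hole ¬vt (app _ vb) refl = ⊥-elim (¬vt (plugE-Val E vb))
decomposeE (valE w p E) (valE w' p' E₂) ¬vt at eq with app-injective eq
... | refl , eq' with decomposeE E E₂ ¬vt at eq'
... | E₃ , refl , et = E₃ , cong (λ q → valE w q (E ∘ᴱ E₃)) (Val-irrelevant p' p) , et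
decomposeE (valE w p E) (funE E₂ u) ¬vt at eq =
  ⊥-elim (Atomic-¬Val at (plugE-Val E₂ (subst Val (proj₁ (app-injective eq)) p)))
decomposeE (funE E u) hole ¬vt (app va _) refl = ⊥-elim (¬vt (plugE-Val E va))
decomposeE (funE E u) (valE w' p' E₂) ¬vt at eq =
  ⊥-elim (¬vt (plugE-Val E (subst Val (sym (proj₁ (app-injective eq))) p')))
decomposeE (funE E u) (funE E₂ u') ¬vt at eq with app-injective eq
... | eq' , refl with decomposeE E E₂ ¬vt at eq'
... | E₃ , refl , et = E₃ , refl , et

decompose : ∀ E F → ¬ Val t → Atomic r → plugE E t ≡ plugF F r →
            Σ ECtx λ F' → (F ≡ E ∘ᶠ F') × (t ≡ plugF F' r)
decompose E (pure E₂) ¬vt at eq with decomposeE E E₂ ¬vt at eq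
... | E₃ , refl , et = pure E₃ , refl , et
decompose E (delim F E₂) ¬vt at eq with decompose E F ¬vt reset eq
... | F' , refl , et = delim F' E₂ , refl , et

value-app-context : ∀ F → Atomic r → Val w → Val v → plugF F r ≡ app w v → F ≡ pure hole
value-app-context (pure hole) _ _ _ _ = refl
value-app-context (pure (valE w' p E)) at _ vv eq =
  ⊥-elim (Atomic-¬Val at (plugE-Val E (subst Val (sym (proj₂ (app-injective eq))) vv)))
value-app-context (pure (funE E u)) at vw _ eq =
  ⊥-elim (Atomic-¬Val at (plugE-Val E (subst Val (sym (proj₁ (app-injective eq))) vw)))
value-app-context (delim F E) at vw vv eq with value-app-context F reset vw vv eq | eq
... | refl | ()

data _↦_ : Tm → Tm → Set where
  β     : ∀ t → Val v → app (lam t) v ↦ (t [ v ])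
  shift : ∀ E t → reset (plugE E (shift t)) ↦ reset (t [ lam (reset (bodyE E)) ])
  reset : Val v → reset v ↦ v

↦-Atomic : r ↦ r' → Atomic r
↦-Atomic (β _ p)     = app (lam _) p
↦-Atomic (shift _ _) = reset
↦-Atomic (reset _)   = reset

↦-β-inv : r ↦ r' → app (lam s) v ≡ r → r' ≡ (s [ v ])
↦-β-inv (β _ _) refl = refl

⟶-plugF : ∀ F → r ↦ r' → plugF F r ⟶ plugF F r'
⟶-plugF F (β t p)     = βv F t _ p
⟶-plugF F (shift E t) = shft F E t
⟶-plugF F (reset p)   = rst F _ p

⟶-inv : a ⟶ b → Σ ECtx λ F → Σ Tm λ r → Σ Tm λ r' → (a ≡ plugF F r) × (b ≡ plugF F r') × (r ↦ r')
⟶-inv (βv F t v p)  = F , _ , _ , refl , refl , β t p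
⟶-inv (shft F E t) = F , _ , _ , refl , refl , shift E t
⟶-inv (rst F v p)  = F , _ , _ , refl , refl , reset p

⟶-plugE : ∀ E → t ⟶ t' → plugE E t ⟶ plugE E t'
⟶-plugE E st with ⟶-inv st
... | F , r , r' , refl , refl , c = subst₂ _⟶_ (plugF-∘ E F r) (plugF-∘ E F r') (⟶-plugF (E ∘ᶠ F) c)

⟶-plugE⁻ : ∀ E → ¬ Val t → plugE E t ⟶ s → Σ Tm λ t' → (t ⟶ t') × (s ≡ plugE E t')
⟶-plugE⁻ E ¬vt st with ⟶-inv st
... | F , r , r' , eq , refl , c with decompose E F ¬vt (↦-Atomic c) eq
... | F' , refl , refl = plugF F' r' , ⟶-plugF F' c , plugF-∘ E F' r'

β-value-inv : Val v → app (lam s) v ⟶ u → u ≡ (s [ v ])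
β-value-inv vv st with ⟶-inv st
... | F , r , r' , eq , refl , c with value-app-context F (↦-Atomic c) (lam _) vv (sym eq)
... | refl = ↦-β-inv c eq

_▻_ : a ⟶* b → b ⟶ c → a ⟶* c
done       ▻ s = step s done
step s' ss ▻ s = step s' (ss ▻ s)

value-app-not-stuck : Val v → ¬ Stuck (app (lam s) v)
value-app-not-stuck vv (inj₁ (E , u , eq)) with value-app-context (pure E) shift (lam _) vv (sym eq) | eq
... | refl | ()
value-app-not-stuck vv (inj₂ (F , y , v , pv , eq)) with value-app-context F (app (var y) pv) (lam _) vv (sym eq) | eq
... | refl | ()

Stuck-plugE : ∀ E → Stuck t → Stuck (plugE E t)
Stuck-plugE E (inj₁ (E₃ , u , refl)) = inj₁ (E ∘ᴱ E₃ , u , sym (plugE-∘ E E₃ (shift u)))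
Stuck-plugE E (inj₂ (F , y , v , pv , refl)) = inj₂ (E ∘ᶠ F , y , v , pv , sym (plugF-∘ E F (app (var y) v)))

Stuck-plugE⁻ : ∀ E → ¬ Val t → Stuck (plugE E t) → Stuck t
Stuck-plugE⁻ E ¬vt (inj₁ (E₂ , u , eq)) =
  let E₃ , _ , et = decomposeE E E₂ ¬vt shift eq in inj₁ (E₃ , u , et)
Stuck-plugE⁻ E ¬vt (inj₂ (F , y , v , pv , eq)) =
  let F' , _ , et = decompose E F ¬vt (app (var y) pv) eq in inj₂ (F' , y , v , pv , et)

ExtCF-refl : (∀ {a} → Q a a) → ∀ F → ExtCF Q F F
ExtCF-refl q (pure E)    = pure q
ExtCF-refl q (delim F E) = delim q q

ExtNF-refl : (∀ {a} → Q a a) → Stuck s → ExtNF Q s s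
ExtNF-refl q (inj₁ (E , t , refl))          = ctrl q q
ExtNF-refl q (inj₂ (F , y , v , pv , refl)) = open' pv pv (ExtCF-refl q F) q

ExtCF-flip : ∀ {F₀ F₁} → ExtCF Q F₀ F₁ → ExtCF (flipR Q) F₁ F₀
ExtCF-flip (pure q)     = pure q
ExtCF-flip (delim q q') = delim q q'

ExtNF-flip : ExtNF Q a b → ExtNF (flipR Q) b a
ExtNF-flip (ctrl q q')         = ctrl q q'
ExtNF-flip (open' p₀ p₁ cf qv) = open' p₁ p₀ (ExtCF-flip cf) qv

Simulates : Rel → Tm → Tm → Set
Simulates Q t₀ t₁ =
    (∀ {t₀'} → t₀ ⟶ t₀' → Σ Tm λ t₁' → (t₁ ⟶* t₁') × Q t₀' t₁')
  × (Val t₀ → Σ Tm λ v₁ → (t₁ ⇓ v₁) × Val v₁ × ExtV Q t₀ v₁)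
  × (Stuck t₀ → Σ Tm λ t₁' → (t₁ ⇓ t₁') × ExtNF Q t₀ t₁')

Simulates-⟶* : (∀ {a} → Q a a) → b ⟶* a → Simulates Q a b
Simulates-⟶* q red =
    (λ st → _ , red ▻ st , q)
  , (λ va → _ , (red , inj₁ va) , va , q)
  , (λ sa → _ , (red , inj₂ sa) , ExtNF-refl q sa)

data _∼_ : Rel where
  same : t ∼ t
  plug : ∀ E t → app (lamE E) t ∼ plugE E t

∼-wk : ∀ E t → plugE (wkE (appLamE E)) t ∼ plugE (wkE E) t
∼-wk E t = subst (λ b → app (lam b) t ∼ plugE (wkE E) t) (sym (ren-bodyE suc E)) (plug (wkE E) t)

∼-ctx : ∀ E F t → plugF (wkF (appLamE E ∘ᶠ F)) t ∼ plugF (wkF (E ∘ᶠ F)) t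
∼-ctx E F t = subst₂ _∼_ (sym (plugF-wk-∘ (appLamE E) F t)) (sym (plugF-wk-∘ E F t)) (∼-wk E (plugF (wkF F) t))

∼-ExtCF : ∀ E F → ExtCF _∼_ (appLamE E ∘ᶠ F) (E ∘ᶠ F)
∼-ExtCF E (pure E')    = pure (∼-ctx E (pure E') (var zero))
∼-ExtCF E (delim F E') = delim same (∼-ctx E F (var zero))

∼-stuck : ∀ E → Stuck t → ExtNF _∼_ (app (lamE E) t) (plugE E t)
∼-stuck E (inj₁ (E₃ , u , refl)) =
  subst (ExtNF _∼_ _) (plugE-∘ E E₃ (shift u))
    (ctrl {E₀ = appLamE E ∘ᴱ E₃} {E₁ = E ∘ᴱ E₃} (∼-ctx E (pure E₃) (var zero)) same)
∼-stuck E (inj₂ (F , y , v , pv , refl)) =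
  subst₂ (ExtNF _∼_) (plugF-∘ (appLamE E) F (app (var y) v)) (plugF-∘ E F (app (var y) v))
    (open' pv pv (∼-ExtCF E F) same)

plug-forward : ∀ E t → Simulates _∼_ (app (lamE E) t) (plugE E t)
plug-forward E t with Val? t
... | yes vt =
    (λ st → plugE E t , done , subst (_∼ plugE E t) (sym (trans (β-value-inv vt st) (bodyE-[] E t))) same)
  , (λ ())
  , (λ st → ⊥-elim (value-app-not-stuck vt st))
... | no ¬vt =
    (λ st → let t' , st' , eq = ⟶-plugE⁻ (appLamE E) ¬vt st in
            plugE E t' , step (⟶-plugE E st') done , subst (_∼ plugE E t') (sym eq) (plug E t'))
  , (λ ())
  , (λ st → let st' = Stuck-plugE⁻ (appLamE E) ¬vt st in
            plugE E t , (done , inj₂ (Stuck-plugE E st')) , ∼-stuck E st')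

plug-backward : ∀ E t → Simulates (flipR _∼_) (plugE E t) (app (lamE E) t)
plug-backward E t with Val? t
... | yes vt = Simulates-⟶* same (step (subst (app (lamE E) t ⟶_) (bodyE-[] E t) (βv (pure hole) (bodyE E) t vt)) done)
... | no ¬vt =
    (λ st → let t' , st' , eq = ⟶-plugE⁻ E ¬vt st in
            app (lamE E) t' , step (⟶-plugE (appLamE E) st') done , subst (app (lamE E) t' ∼_) (sym eq) (plug E t'))
  , (λ vt → ⊥-elim (¬vt (plugE-Val E vt)))
  , (λ st → let st' = Stuck-plugE⁻ E ¬vt st in
            app (lamE E) t , (done , inj₂ (Stuck-plugE (appLamE E) st')) , ExtNF-flip (∼-stuck E st'))

∼-isNFBisim : IsNFBisim _∼_
∼-isNFBisim = forward , backward
  where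
  forward : Progress _∼_
  forward same       = Simulates-⟶* same done
  forward (plug E t) = plug-forward E t
  backward : Progress (flipR _∼_)
  backward same       = Simulates-⟶* same done
  backward (plug E t) = plug-backward E t

proposition6p29 : (E : PCtx) (t : Tm) → app (lam (plugE (wkE E) (var zero))) t ≈nf plugE E t
proposition6p29 E t = _∼_ , ∼-isNFBisim , plug E t
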